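{- The symmetric group $\mathfrak S_n$ satisfies property $\mathcal P^+(2)$ if and only if $n\ge4$. The alternating group $\mathfrak A_n$ satisfies property $\mathcal P^+(2)$ if and only if $n\ge6$.
   Context: For a finite group $\Gamma$, $\ell\ge1$ and $x\in\Gamma$, $r_\ell(x)=|\{g\in\Gamma:g^\ell=x\}|$. A finite group $G^+$ satisfies $\mathcal P^+(2)$ if there exist $a,b\in G^+$ conjugate in $G^+$ and a subgroup $G\subset G^+$ containing $a,b$ such that, in $G$, $a$ and $b$ have the same order and $0=r_2(a)<r_2(b)$ (i.e. $a$ is not a square in $G$ while $b$ is a square in $G$). -}

module Defs where

open import Data.Nat using (ℕ; zero; suc; _%_; _<_)
open import Data.Fin using (Fin) renaming (_<?_ to _<ᶠ?_)
open import Data.Fin.Permutation using (Permutation′; _⟨$⟩ʳ_; _≈_; id; flip; _∘ₚ_)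
open import Data.List using (List; length; filter; allFin; cartesianProduct)
open import Data.Product using (Σ; ∃; ∃-syntax; _×_; _,_)
open import Relation.Nullary using (¬_)
open import Relation.Nullary.Decidable using (_×-dec_)
open import Relation.Binary.PropositionalEquality using (_≡_)

-- The symmetric group 𝔖_n is realised as Permutation′ n (bijections of Fin n),
-- with equality of elements given by pointwise equality _≈_.
-- Group law: _∘ₚ_ (π ∘ₚ ρ applies π first), unit id, inverse flip.

Perm : ℕ → Set
Perm n = Permutation′ n

pow : ∀ {n} → Perm n → ℕ → Perm n
pow g zero    = id
pow g (suc k) = g ∘ₚ pow g k

SubsetOf : ℕ → Set₁
SubsetOf n = Perm n → Set

record IsSubgroup {n : ℕ} (G : SubsetOf n) : Set where
  field
    resp  : ∀ {g h} → g ≈ h → G g → G h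
    unit  : G id
    mul   : ∀ {g h} → G g → G h → G (g ∘ₚ h)
    inv   : ∀ {g} → G g → G (flip g)

Sym : (n : ℕ) → SubsetOf n
Sym n σ = Data.Unit.⊤
  where import Data.Unit

inversions : ∀ {n} → Perm n → ℕ
inversions {n} σ =
  length (filter (λ p → (Data.Product.proj₁ p <ᶠ? Data.Product.proj₂ p)
                        ×-dec ((σ ⟨$⟩ʳ Data.Product.proj₂ p) <ᶠ? (σ ⟨$⟩ʳ Data.Product.proj₁ p)))
                 (cartesianProduct (allFin n) (allFin n)))
  where import Data.Product

Alt : (n : ℕ) → SubsetOf n
Alt n σ = inversions σ % 2 ≡ 0

HasOrder : ∀ {n} → Perm n → ℕ → Set
HasOrder g k = (0 < k) × (pow g k ≈ id) × (∀ j → 0 < j → j < k → ¬ (pow g j ≈ id))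

-- x is a square in G, i.e. r₂(x) > 0 computed in G.
IsSquareIn : ∀ {n} → SubsetOf n → Perm n → Set
IsSquareIn G x = ∃[ g ] (G g × (g ∘ₚ g ≈ x))

ConjugateIn : ∀ {n} → SubsetOf n → Perm n → Perm n → Set
ConjugateIn G⁺ a b = ∃[ h ] (G⁺ h × ((flip h ∘ₚ a ∘ₚ h) ≈ b))

P⁺2 : ∀ {n} → SubsetOf n → Set₁
P⁺2 {n} G⁺ =
  Σ (Perm n) λ a → Σ (Perm n) λ b →
    ConjugateIn G⁺ a b ×
    Σ (SubsetOf n) λ G →
      IsSubgroup G × (∀ g → G g → G⁺ g) × G a × G b ×
      (∃[ k ] (HasOrder a k × HasOrder b k)) ×
      ¬ IsSquareIn G a × IsSquareIn G b

-- If every square of G⁺ has odd order, 𝒫⁺(2) fails: a has the same order k as a square, so k is odd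
-- and a is the square of a^((k+1)/2) inside any subgroup containing it. Enumerating the permutations
-- shows that squares have exponent 3 in 𝔖₃ and exponent 15 in 𝔄₅. Conversely, in the dihedral group
-- of order 8 inside 𝔖₄ the reflection (0 1)(2 3) is not a square, while the half-turn (0 2)(1 3) is,
-- and (1 2) conjugates one to the other; multiplying the odd elements (and the conjugator) by (4 5)
-- moves this configuration into 𝔄₆. Since 𝒫⁺(2) passes from 𝔖_k to 𝔖_n and from 𝔄_k to 𝔄_n for
-- k ≤ n, through the embedding fixing the new points, this gives both thresholds.

module Submission where

open import Defs
open import Data.Bool using (true; false)
open import Data.Empty using (⊥-elim)
open import Data.Fin as Fin using (Fin; suc; _≟_)
open import Data.Fin.Patterns using (0F; 1F; 2F; 3F; 4F; 5F)
open import Data.Fin.Permutation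
  using (_⟨$⟩ʳ_; _⟨$⟩ˡ_; _≈_; id; flip; _∘ₚ_; inverseˡ; inverseʳ; transpose; lift₀; remove; lift₀-remove; lift₀-cong)
import Data.Fin.Permutation.Components as PC
open import Data.Fin.Properties using (all?; any?; suc-injective)
open import Data.List using (List; []; _∷_; _++_; map; filter; length; allFin; cartesianProduct; cartesianProductWith)
open import Data.List.Membership.Propositional using (_∈_)
open import Data.List.Membership.Propositional.Properties using (∈-cartesianProductWith⁺; ∈-allFin)
open import Data.List.Properties using (filter-≐; filter-++; length-++; map-tabulate; map-∘)
open import Data.List.Relation.Unary.All as All using (All)
open import Data.List.Relation.Unary.Any using (here)
open import Data.Nat as ℕ using (ℕ; zero; suc; _+_; _*_; _%_; _/_; _<_; _≤_; s≤s; z≤n)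
open import Data.Nat.DivMod using (m≡m%n+[m/n]*n; m%n<n)
open import Data.Nat.Divisibility using (_∣_; divides; m%n≡0⇒n∣m)
open import Data.Nat.Properties using (+-suc; +-comm; +-identityʳ; _≤?_; ≰⇒>; m≤n⇒∃[o]m+o≡n)
open import Data.Product using (_×_; _,_; ∃-syntax; proj₁; proj₂)
import Data.Vec as Vec
open import Data.Unit using (tt)
open import Function using (_∘_)
open import Function.Bundles using (_⇔_; mk⇔)
open import Relation.Binary.PropositionalEquality
open import Relation.Nullary using (¬_; Dec; yes; no; does; ¬?)
open import Relation.Nullary.Decidable using (_×-dec_; _→-dec_; dec-true; map′; from-yes; True; False; toWitness; toWitnessFalse)
open import Relation.Unary using (Decidable)

private variable
  k n N : ℕ

∘ₚ-cong : (π π′ ρ ρ′ : Perm n) → π ≈ π′ → ρ ≈ ρ′ → π ∘ₚ ρ ≈ π′ ∘ₚ ρ′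
∘ₚ-cong π π′ ρ ρ′ π≈π′ ρ≈ρ′ i = trans (cong (ρ ⟨$⟩ʳ_) (π≈π′ i)) (ρ≈ρ′ _)

flip-cong : (π ρ : Perm n) → π ≈ ρ → flip π ≈ flip ρ
flip-cong π ρ π≈ρ i = begin
  π ⟨$⟩ˡ i                    ≡⟨ cong (π ⟨$⟩ˡ_) (sym (inverseʳ ρ)) ⟩
  π ⟨$⟩ˡ (ρ ⟨$⟩ʳ (ρ ⟨$⟩ˡ i))  ≡⟨ cong (π ⟨$⟩ˡ_) (sym (π≈ρ _)) ⟩
  π ⟨$⟩ˡ (π ⟨$⟩ʳ (ρ ⟨$⟩ˡ i))  ≡⟨ inverseˡ π ⟩
  ρ ⟨$⟩ˡ i                    ∎
  where open ≡-Reasoning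

pow-cong : (π ρ : Perm n) → π ≈ ρ → ∀ j → pow π j ≈ pow ρ j
pow-cong π ρ π≈ρ zero    x = refl
pow-cong π ρ π≈ρ (suc j) x = trans (cong (pow π j ⟨$⟩ʳ_) (π≈ρ x)) (pow-cong π ρ π≈ρ j _)

pow-+ : (π : Perm n) (i j : ℕ) → pow π (i + j) ≈ pow π i ∘ₚ pow π j
pow-+ π zero    j x = refl
pow-+ π (suc i) j x = pow-+ π i j (π ⟨$⟩ʳ x)

pow-multiple : (π : Perm n) {k e : ℕ} → pow π k ≈ id → k ∣ e → pow π e ≈ id
pow-multiple π {k} πᵏ≈id (divides q refl) = go q
  where
  go : ∀ q → pow π (q * k) ≈ id
  go zero    x = refl
  go (suc q) x = begin
    pow π (k + q * k) ⟨$⟩ʳ x              ≡⟨ pow-+ π k (q * k) x ⟩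
    pow π (q * k) ⟨$⟩ʳ (pow π k ⟨$⟩ʳ x)   ≡⟨ go q _ ⟩
    pow π k ⟨$⟩ʳ x                        ≡⟨ πᵏ≈id x ⟩
    x                                     ∎
    where open ≡-Reasoning

order-divides : (π : Perm n) {k e : ℕ} → HasOrder π k → pow π e ≈ id → k ∣ e
order-divides π {suc k} {e} (_ , πᵏ≈id , minimal) πᵉ≈id =
  m%n≡0⇒n∣m e (suc k) (remainder-trivial r (m%n<n e (suc k)) πʳ≈id)
  where
  r = e % suc k
  q = e / suc k
  πʳ≈id : pow π r ≈ id
  πʳ≈id x = begin
    pow π r ⟨$⟩ʳ x                            ≡⟨ sym (pow-multiple π πᵏ≈id (divides q refl) _) ⟩
    pow π (q * suc k) ⟨$⟩ʳ (pow π r ⟨$⟩ʳ x)   ≡⟨ sym (pow-+ π r (q * suc k) x) ⟩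
    pow π (r + q * suc k) ⟨$⟩ʳ x              ≡⟨ cong (λ j → pow π j ⟨$⟩ʳ x) (sym (m≡m%n+[m/n]*n e (suc k))) ⟩
    pow π e ⟨$⟩ʳ x                            ≡⟨ πᵉ≈id x ⟩
    x                                         ∎
    where open ≡-Reasoning
  remainder-trivial : ∀ r → r < suc k → pow π r ≈ id → r ≡ 0
  remainder-trivial zero    _   _     = refl
  remainder-trivial (suc r) r<k πʳ≈id = ⊥-elim (minimal (suc r) (s≤s z≤n) r<k πʳ≈id)

infix 4 _≈?_

_≈?_ : (π ρ : Perm n) → Dec (π ≈ ρ)
π ≈? ρ = all? λ i → π ⟨$⟩ʳ i ≟ ρ ⟨$⟩ʳ i

involution-order : (π : Perm n) → {True (π ∘ₚ π ≈? id)} → {False (π ≈? id)} → HasOrder π 2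
involution-order π {π²≈id} {π≉id} = s≤s z≤n , toWitness π²≈id , minimal
  where
  minimal : ∀ j → 0 < j → j < 2 → ¬ pow π j ≈ id
  minimal 1 _ _ = toWitnessFalse π≉id
  minimal (suc (suc j)) _ (s≤s (s≤s ()))

pow-closed : {G : SubsetOf n} → IsSubgroup G → ∀ {π} → G π → ∀ j → G (pow π j)
pow-closed G-subgroup Gπ zero    = IsSubgroup.unit G-subgroup
pow-closed G-subgroup Gπ (suc j) = IsSubgroup.mul G-subgroup Gπ (pow-closed G-subgroup Gπ j)

square-root-of-odd-order : (π : Perm n) (M : ℕ) → pow π (suc (2 * M)) ≈ id →
                           pow π (suc M) ∘ₚ pow π (suc M) ≈ π
square-root-of-odd-order π M πᴱ≈id x = begin
  pow π (suc M) ⟨$⟩ʳ (pow π (suc M) ⟨$⟩ʳ x)  ≡⟨ sym (pow-+ π (suc M) (suc M) x) ⟩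
  pow π (suc M + suc M) ⟨$⟩ʳ x              ≡⟨ cong (λ j → pow π j ⟨$⟩ʳ x) 2M+2≡ ⟩
  pow π (suc (2 * M)) ⟨$⟩ʳ (π ⟨$⟩ʳ x)        ≡⟨ πᴱ≈id _ ⟩
  π ⟨$⟩ʳ x                                  ∎
  where
  open ≡-Reasoning
  2M+2≡ : suc M + suc M ≡ suc (suc (2 * M))
  2M+2≡ = cong suc (trans (+-suc M M) (cong (λ m → suc (M + m)) (sym (+-identityʳ M))))

SquaresHaveExponent : SubsetOf n → ℕ → Set
SquaresHaveExponent G E = ∀ g → G g → pow (g ∘ₚ g) E ≈ id

oddSquareExponent⇒¬P⁺2 : {G⁺ : SubsetOf n} (M : ℕ) → SquaresHaveExponent G⁺ (suc (2 * M)) → ¬ P⁺2 G⁺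
oddSquareExponent⇒¬P⁺2 M squares-exp
  (a , b , _ , G , G-subgroup , G⊆G⁺ , Ga , _ , (k , a-order , b-order) , a-nonsquare , (r , Gr , r²≈b)) =
  a-nonsquare (pow a (suc M) , pow-closed G-subgroup Ga (suc M) , square-root-of-odd-order a M aᴱ≈id)
  where
  E = suc (2 * M)
  bᴱ≈id : pow b E ≈ id
  bᴱ≈id x = trans (pow-cong b (r ∘ₚ r) (λ i → sym (r²≈b i)) E x) (squares-exp r (G⊆G⁺ r Gr) x)
  aᴱ≈id : pow a E ≈ id
  aᴱ≈id = pow-multiple a (proj₁ (proj₂ a-order)) (order-divides b {e = E} b-order bᴱ≈id)

inversion? : (π : Perm n) →
             Decidable (λ (p : Fin n × Fin n) → proj₁ p Fin.< proj₂ p × π ⟨$⟩ʳ proj₂ p Fin.< π ⟨$⟩ʳ proj₁ p)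
inversion? π p = (proj₁ p Fin.<? proj₂ p) ×-dec (π ⟨$⟩ʳ proj₂ p Fin.<? π ⟨$⟩ʳ proj₁ p)

countInversions : (π : Perm n) → List (Fin n × Fin n) → ℕ
countInversions π ps = length (filter (inversion? π) ps)

countInversions-++ : (π : Perm n) (ps qs : List (Fin n × Fin n)) →
                     countInversions π (ps ++ qs) ≡ countInversions π ps + countInversions π qs
countInversions-++ π ps qs = trans (cong length (filter-++ (inversion? π) ps qs)) (length-++ (filter (inversion? π) ps))

inversions-cong : (π ρ : Perm n) → π ≈ ρ → inversions π ≡ inversions ρ
inversions-cong π ρ π≈ρ =
  cong length (filter-≐ (inversion? π) (inversion? ρ)
                 ((λ (i<j , inv) → i<j , subst₂ Fin._<_ (π≈ρ _) (π≈ρ _) inv)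
                 , (λ (i<j , inv) → i<j , subst₂ Fin._<_ (sym (π≈ρ _)) (sym (π≈ρ _)) inv))
                 (cartesianProduct (allFin _) (allFin _)))

Sym-resp : (π ρ : Perm n) → π ≈ ρ → Sym n π → Sym n ρ
Sym-resp _ _ _ _ = tt

Alt-resp : (π ρ : Perm n) → π ≈ ρ → Alt n π → Alt n ρ
Alt-resp π ρ π≈ρ Altπ = trans (cong (_% 2) (sym (inversions-cong π ρ π≈ρ))) Altπ

length-filter-map-cong : {A B C : Set} {P : A → Set} {Q : B → Set} (P? : Decidable P) (Q? : Decidable Q)
                         {f : C → A} {g : C → B} → (∀ c → does (P? (f c)) ≡ does (Q? (g c))) →
                         ∀ cs → length (filter P? (map f cs)) ≡ length (filter Q? (map g cs))
length-filter-map-cong P? Q? {f} {g} same []       = refl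
length-filter-map-cong P? Q? {f} {g} same (c ∷ cs) with does (P? (f c)) | does (Q? (g c)) | same c
... | true  | true  | _ = cong suc (length-filter-map-cong P? Q? same cs)
... | false | false | _ = length-filter-map-cong P? Q? same cs

-- The pairs involving the new point 0F are never inversions of lift₀ π; the others are those of π, shifted.
module _ (π : Perm n) where

  private
    row-0F : ∀ js → countInversions (lift₀ π) (map (0F ,_) (map suc js)) ≡ 0
    row-0F []       = refl
    row-0F (j ∷ js) = row-0F js

    row-suc : ∀ i js → countInversions (lift₀ π) (map (suc i ,_) (map suc js)) ≡ countInversions π (map (i ,_) js)
    row-suc i js = trans (cong (countInversions (lift₀ π)) (sym (map-∘ js)))
                         (length-filter-map-cong (inversion? (lift₀ π)) (inversion? π) (λ _ → refl) js)

    rows-suc : ∀ is js → countInversions (lift₀ π) (cartesianProduct (map suc is) (0F ∷ map suc js))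
                         ≡ countInversions π (cartesianProduct is js)
    rows-suc []       js = refl
    rows-suc (i ∷ is) js = begin
      countInversions (lift₀ π) (map (suc i ,_) (0F ∷ map suc js) ++ cartesianProduct (map suc is) (0F ∷ map suc js))
        ≡⟨ countInversions-++ (lift₀ π) (map (suc i ,_) (0F ∷ map suc js)) _ ⟩
      countInversions (lift₀ π) (map (suc i ,_) (map suc js))
        + countInversions (lift₀ π) (cartesianProduct (map suc is) (0F ∷ map suc js))
        ≡⟨ cong₂ _+_ (row-suc i js) (rows-suc is js) ⟩
      countInversions π (map (i ,_) js) + countInversions π (cartesianProduct is js)
        ≡⟨ sym (countInversions-++ π (map (i ,_) js) _) ⟩
      countInversions π (cartesianProduct (i ∷ is) js) ∎
      where open ≡-Reasoning

  inversions-lift₀ : inversions (lift₀ π) ≡ inversions π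
  inversions-lift₀ = begin
    inversions (lift₀ π)
      ≡⟨ cong (λ is → countInversions (lift₀ π) (cartesianProduct (0F ∷ is) (0F ∷ is))) (sym (map-tabulate (λ i → i) suc)) ⟩
    countInversions (lift₀ π) (map (0F ,_) (0F ∷ map suc is) ++ cartesianProduct (map suc is) (0F ∷ map suc is))
      ≡⟨ countInversions-++ (lift₀ π) (map (0F ,_) (0F ∷ map suc is)) _ ⟩
    countInversions (lift₀ π) (map (0F ,_) (map suc is))
      + countInversions (lift₀ π) (cartesianProduct (map suc is) (0F ∷ map suc is))
      ≡⟨ cong₂ _+_ (row-0F is) (rows-suc is is) ⟩
    inversions π ∎
    where
    open ≡-Reasoning
    is = allFin n

-- Enumerating permutations

transpose-source : (i j : Fin n) → PC.transpose i j i ≡ j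
transpose-source i j rewrite dec-true (i ≟ i) refl = refl

decompose-via-lift₀ : (π : Perm (suc n)) →
            let j = π ⟨$⟩ʳ 0F in π ≈ lift₀ (remove 0F (π ∘ₚ transpose j 0F)) ∘ₚ transpose 0F j
decompose-via-lift₀ π x = begin
  π ⟨$⟩ʳ x                                                            ≡⟨ sym (PC.transpose-inverse 0F j) ⟩
  PC.transpose 0F j ((π ∘ₚ transpose j 0F) ⟨$⟩ʳ x)                    ≡⟨ cong (PC.transpose 0F j) (sym (π′-lifted x)) ⟩
  PC.transpose 0F j (lift₀ (remove 0F (π ∘ₚ transpose j 0F)) ⟨$⟩ʳ x)  ∎
  where
  open ≡-Reasoning
  j = π ⟨$⟩ʳ 0F
  π′-lifted = lift₀-remove (π ∘ₚ transpose j 0F) (transpose-source j 0F)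

allPerms : ∀ n → List (Perm n)
allPerms zero    = id ∷ []
allPerms (suc n) = cartesianProductWith (λ j ρ → lift₀ ρ ∘ₚ transpose 0F j) (allFin (suc n)) (allPerms n)

allPerms-complete : ∀ n (π : Perm n) → ∃[ ρ ] (ρ ∈ allPerms n × π ≈ ρ)
allPerms-complete zero    π = id , here refl , λ ()
allPerms-complete (suc n) π with allPerms-complete n (remove 0F (π ∘ₚ transpose (π ⟨$⟩ʳ 0F) 0F))
... | ρ , ρ∈ , π′≈ρ =
  lift₀ ρ ∘ₚ transpose 0F j ,
  ∈-cartesianProductWith⁺ (λ j ρ → lift₀ ρ ∘ₚ transpose 0F j) (∈-allFin j) ρ∈ ,
  λ x → trans (decompose-via-lift₀ π x) (cong (PC.transpose 0F j) (lift₀-cong _ ρ π′≈ρ x))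
  where j = π ⟨$⟩ʳ 0F

all-perms? : {P : Perm n → Set} → Decidable P → (∀ π ρ → π ≈ ρ → P π → P ρ) → Dec (∀ π → P π)
all-perms? {n} {P} P? P-resp = map′ every (λ ∀P → All.tabulate λ {π} _ → ∀P π) (All.all? P? (allPerms n))
  where
  every : All P (allPerms n) → ∀ π → P π
  every all-P π with allPerms-complete n π
  ... | ρ , ρ∈ , π≈ρ = P-resp ρ π (λ i → sym (π≈ρ i)) (All.lookup all-P ρ∈)

squaresHaveExponent? : {G : SubsetOf n} → Decidable G → (∀ π ρ → π ≈ ρ → G π → G ρ) → ∀ E → Dec (SquaresHaveExponent G E)
squaresHaveExponent? {G = G} G? G-resp E =
  all-perms? {P = λ π → G π → pow (π ∘ₚ π) E ≈ id} (λ π → G? π →-dec (pow (π ∘ₚ π) E ≈? id))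
    λ π ρ π≈ρ π-ok Gρ x →
      trans (sym (pow-cong (π ∘ₚ π) (ρ ∘ₚ ρ) (∘ₚ-cong π ρ π ρ π≈ρ π≈ρ) E x))
            (π-ok (G-resp ρ π (λ i → sym (π≈ρ i)) Gρ) x)

Alt? : Decidable (Alt n)
Alt? π = inversions π % 2 ℕ.≟ 0

-- Squares in 𝔖₃ have order 1 or 3, squares in 𝔄₅ have order 1, 3 or 5.
¬P⁺2-Sym3 : ¬ P⁺2 (Sym 3)
¬P⁺2-Sym3 = oddSquareExponent⇒¬P⁺2 1 (from-yes (squaresHaveExponent? {G = Sym 3} (λ _ → yes tt) Sym-resp 3))

¬P⁺2-Alt5 : ¬ P⁺2 (Alt 5)
¬P⁺2-Alt5 = oddSquareExponent⇒¬P⁺2 7 (from-yes (squaresHaveExponent? {G = Alt 5} Alt? Alt-resp 15))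

-- Embedding 𝔖_n into 𝔖_(m + n)

lift : ∀ m → Perm n → Perm (m + n)
lift zero    π = π
lift (suc m) π = lift₀ (lift m π)

lift-cong : ∀ m (π ρ : Perm n) → π ≈ ρ → lift m π ≈ lift m ρ
lift-cong zero    π ρ π≈ρ = π≈ρ
lift-cong (suc m) π ρ π≈ρ = lift₀-cong (lift m π) (lift m ρ) (lift-cong m π ρ π≈ρ)

lift-id : ∀ m → lift m (id {n}) ≈ id
lift-id zero    x       = refl
lift-id (suc m) 0F      = refl
lift-id (suc m) (suc x) = cong suc (lift-id m x)

lift-∘ : ∀ m (π ρ : Perm n) → lift m (π ∘ₚ ρ) ≈ lift m π ∘ₚ lift m ρ
lift-∘ zero    π ρ x       = refl
lift-∘ (suc m) π ρ 0F      = refl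
lift-∘ (suc m) π ρ (suc x) = cong suc (lift-∘ m π ρ x)

lift-flip : ∀ m (π : Perm n) → lift m (flip π) ≈ flip (lift m π)
lift-flip zero    π x       = refl
lift-flip (suc m) π 0F      = refl
lift-flip (suc m) π (suc x) = cong suc (lift-flip m π x)

lift-injective : ∀ m (π ρ : Perm n) → lift m π ≈ lift m ρ → π ≈ ρ
lift-injective zero    π ρ eq = eq
lift-injective (suc m) π ρ eq = lift-injective m π ρ (λ x → suc-injective (eq (suc x)))

pow-lift : ∀ m (π : Perm n) j → pow (lift m π) j ≈ lift m (pow π j)
pow-lift m π zero    x = sym (lift-id m x)
pow-lift m π (suc j) x = trans (pow-lift m π j _) (sym (lift-∘ m π (pow π j) x))

hasOrder-lift : ∀ m {π : Perm n} {k} → HasOrder π k → HasOrder (lift m π) k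
hasOrder-lift m {π} {k} (0<k , πᵏ≈id , minimal) = 0<k , liftᵏ≈id , lift-minimal
  where
  liftᵏ≈id : pow (lift m π) k ≈ id
  liftᵏ≈id x = trans (pow-lift m π k x) (trans (lift-cong m (pow π k) id πᵏ≈id x) (lift-id m x))
  lift-minimal : ∀ j → 0 < j → j < k → ¬ pow (lift m π) j ≈ id
  lift-minimal j 0<j j<k liftʲ≈id = minimal j 0<j j<k
    (lift-injective m (pow π j) id λ x → trans (sym (pow-lift m π j x)) (trans (liftʲ≈id x) (sym (lift-id m x))))

inversions-lift : ∀ m (π : Perm n) → inversions (lift m π) ≡ inversions π
inversions-lift zero    π = refl
inversions-lift (suc m) π = trans (inversions-lift₀ (lift m π)) (inversions-lift m π)

Lifted : ∀ m → SubsetOf n → SubsetOf (m + n)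
Lifted m G π = ∃[ ρ ] (G ρ × π ≈ lift m ρ)

lifted-isSubgroup : ∀ m {G : SubsetOf n} → IsSubgroup G → IsSubgroup (Lifted m G)
lifted-isSubgroup m G-subgroup = record
  { resp = λ { {g} {h} g≈h (ρ , Gρ , g≈ρ) → ρ , Gρ , λ x → trans (sym (g≈h x)) (g≈ρ x) }
  ; unit = id , unit , λ x → sym (lift-id m x)
  ; mul  = λ { {g} {h} (ρ , Gρ , g≈ρ) (τ , Gτ , h≈τ) →
               ρ ∘ₚ τ , mul Gρ Gτ ,
               λ x → trans (∘ₚ-cong g (lift m ρ) h (lift m τ) g≈ρ h≈τ x) (sym (lift-∘ m ρ τ x)) }
  ; inv  = λ { {g} (ρ , Gρ , g≈ρ) →
               flip ρ , inv Gρ , λ x → trans (flip-cong g (lift m ρ) g≈ρ x) (sym (lift-flip m ρ x)) }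
  }
  where open IsSubgroup G-subgroup

P⁺2-lift : ∀ m {G⁺ : SubsetOf n} → P⁺2 G⁺ → P⁺2 (Lifted m G⁺)
P⁺2-lift m (a , b , (h , G⁺h , conj) , G , G-subgroup , G⊆G⁺ , Ga , Gb , (k , a-order , b-order) ,
            a-nonsquare , (r , Gr , r²≈b)) =
  lift m a , lift m b , (lift m h , (h , G⁺h , λ _ → refl) , lifted-conj) ,
  Lifted m G , lifted-isSubgroup m G-subgroup , (λ { g (ρ , Gρ , g≈ρ) → ρ , G⊆G⁺ ρ Gρ , g≈ρ }) ,
  (a , Ga , λ _ → refl) , (b , Gb , λ _ → refl) , (k , hasOrder-lift m a-order , hasOrder-lift m b-order) ,
  lifted-nonsquare , (lift m r , (r , Gr , λ _ → refl) , lifted-square)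
  where
  lifted-conj : flip (lift m h) ∘ₚ lift m a ∘ₚ lift m h ≈ lift m b
  lifted-conj x = begin
    lift m h ⟨$⟩ʳ (lift m a ⟨$⟩ʳ (flip (lift m h) ⟨$⟩ʳ x))  ≡⟨ cong (λ y → lift m h ⟨$⟩ʳ (lift m a ⟨$⟩ʳ y)) (sym (lift-flip m h x)) ⟩
    lift m h ⟨$⟩ʳ (lift m a ⟨$⟩ʳ (lift m (flip h) ⟨$⟩ʳ x))  ≡⟨ cong (lift m h ⟨$⟩ʳ_) (sym (lift-∘ m (flip h) a x)) ⟩
    lift m h ⟨$⟩ʳ (lift m (flip h ∘ₚ a) ⟨$⟩ʳ x)             ≡⟨ sym (lift-∘ m (flip h ∘ₚ a) h x) ⟩
    lift m (flip h ∘ₚ a ∘ₚ h) ⟨$⟩ʳ x                        ≡⟨ lift-cong m _ b conj x ⟩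
    lift m b ⟨$⟩ʳ x                                         ∎
    where open ≡-Reasoning
  lifted-square : lift m r ∘ₚ lift m r ≈ lift m b
  lifted-square x = trans (sym (lift-∘ m r r x)) (lift-cong m (r ∘ₚ r) b r²≈b x)
  lifted-nonsquare : ¬ IsSquareIn (Lifted m G) (lift m a)
  lifted-nonsquare (g , (ρ , Gρ , g≈ρ) , g²≈a) = a-nonsquare (ρ , Gρ , lift-injective m (ρ ∘ₚ ρ) a
    λ x → trans (lift-∘ m ρ ρ x) (trans (sym (∘ₚ-cong g (lift m ρ) g (lift m ρ) g≈ρ g≈ρ x)) (g²≈a x)))

P⁺2-mono : {G⁺ H⁺ : SubsetOf n} → (∀ g → G⁺ g → H⁺ g) → P⁺2 G⁺ → P⁺2 H⁺
P⁺2-mono G⁺⊆H⁺ (a , b , (h , G⁺h , conj) , G , G-subgroup , G⊆G⁺ , rest) =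
  a , b , (h , G⁺⊆H⁺ h G⁺h , conj) , G , G-subgroup , (λ g Gg → G⁺⊆H⁺ g (G⊆G⁺ g Gg)) , rest

P⁺2-Sym-≤ : P⁺2 (Sym k) → k ≤ n → P⁺2 (Sym n)
P⁺2-Sym-≤ {k} p k≤n with m≤n⇒∃[o]m+o≡n k≤n
... | m , refl = subst (λ n → P⁺2 (Sym n)) (+-comm m k) (P⁺2-mono (λ _ _ → tt) (P⁺2-lift m p))

P⁺2-Alt-≤ : P⁺2 (Alt k) → k ≤ n → P⁺2 (Alt n)
P⁺2-Alt-≤ {k} p k≤n with m≤n⇒∃[o]m+o≡n k≤n
... | m , refl = subst (λ n → P⁺2 (Alt n)) (+-comm m k) (P⁺2-mono lifted-even (P⁺2-lift m p))
  where
  lifted-even : ∀ g → Lifted m (Alt k) g → Alt (m + k) g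
  lifted-even g (ρ , Altρ , g≈ρ) =
    trans (cong (_% 2) (trans (inversions-cong g (lift m ρ) g≈ρ) (inversions-lift m ρ))) Altρ

Span : (Fin N → Perm n) → SubsetOf n
Span σ π = ∃[ d ] (π ≈ σ d)

ClosedFamily : (Fin N → Perm n) → Set
ClosedFamily σ = (∃[ d ] (id ≈ σ d))
               × (∀ i j → ∃[ d ] (σ i ∘ₚ σ j ≈ σ d))
               × (∀ i → ∃[ d ] (flip (σ i) ≈ σ d))

closedFamily? : (σ : Fin N → Perm n) → Dec (ClosedFamily σ)
closedFamily? σ = any? (λ d → id ≈? σ d)
            ×-dec all? (λ i → all? λ j → any? λ d → σ i ∘ₚ σ j ≈? σ d)
            ×-dec all? (λ i → any? λ d → flip (σ i) ≈? σ d)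

span-isSubgroup : (σ : Fin N → Perm n) → ClosedFamily σ → IsSubgroup (Span σ)
span-isSubgroup σ (unit , mul , inv) = record
  { resp = λ { {g} {h} g≈h (d , g≈σd) → d , λ x → trans (sym (g≈h x)) (g≈σd x) }
  ; unit = unit
  ; mul  = λ { {g} {h} (i , g≈σi) (j , h≈σj) → let d , σiσj≈σd = mul i j in
               d , λ x → trans (∘ₚ-cong g (σ i) h (σ j) g≈σi h≈σj x) (σiσj≈σd x) }
  ; inv  = λ { {g} (i , g≈σi) → let d , σi⁻¹≈σd = inv i in
               d , λ x → trans (flip-cong g (σ i) g≈σi x) (σi⁻¹≈σd x) }
  }

P⁺2-from-family : {G⁺ : SubsetOf n} (σ : Fin N → Perm n) → ClosedFamily σ →
                  (∀ π ρ → π ≈ ρ → G⁺ π → G⁺ ρ) → (∀ d → G⁺ (σ d)) →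
                  (a r : Fin N) (t : Perm n) → G⁺ t → flip t ∘ₚ σ a ∘ₚ t ≈ σ r ∘ₚ σ r →
                  HasOrder (σ a) k → HasOrder (σ r ∘ₚ σ r) k → (∀ d → ¬ σ d ∘ₚ σ d ≈ σ a) → P⁺2 G⁺
P⁺2-from-family {k = k} σ closed@(_ , mul , _) G⁺-resp G⁺σ a r t G⁺t conj a-order b-order no-root =
  σ a , σ r ∘ₚ σ r , (t , G⁺t , conj) , Span σ , span-isSubgroup σ closed ,
  (λ { g (d , g≈σd) → G⁺-resp (σ d) g (λ x → sym (g≈σd x)) (G⁺σ d) }) ,
  (a , λ _ → refl) , mul r r , (k , a-order , b-order) , nonsquare , (σ r , (r , λ _ → refl) , λ _ → refl)
  where
  nonsquare : ¬ IsSquareIn (Span σ) (σ a)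
  nonsquare (g , (d , g≈σd) , g²≈σa) =
    no-root d (λ x → trans (sym (∘ₚ-cong g (σ d) g (σ d) g≈σd g≈σd x)) (g²≈σa x))

dihedral : Perm n → Perm n → Fin 8 → Perm n
dihedral r s = Vec.lookup (rotations Vec.++ Vec.map (_∘ₚ s) rotations)
  where rotations = Vec.tabulate {n = 4} (pow r ∘ Fin.toℕ)

square-rotation : Perm (4 + n)
square-rotation = transpose 0F 1F ∘ₚ transpose 0F 2F ∘ₚ transpose 0F 3F

square-reflection : Perm (4 + n)
square-reflection = transpose 0F 1F ∘ₚ transpose 2F 3F

-- In the dihedral family the reflection s is index 4F and the rotation r is index 1F.
P⁺2-Sym4 : P⁺2 (Sym 4)
P⁺2-Sym4 =
  P⁺2-from-family σ (from-yes (closedFamily? σ)) Sym-resp (λ _ → tt) 4F 1F t tt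
    (from-yes (flip t ∘ₚ σ 4F ∘ₚ t ≈? σ 1F ∘ₚ σ 1F))
    (involution-order (σ 4F)) (involution-order (σ 1F ∘ₚ σ 1F))
    (from-yes (all? λ d → ¬? (σ d ∘ₚ σ d ≈? σ 4F)))
  where
  σ = dihedral square-rotation square-reflection
  t = transpose 1F 2F

P⁺2-Alt6 : P⁺2 (Alt 6)
P⁺2-Alt6 =
  P⁺2-from-family σ (from-yes (closedFamily? σ)) Alt-resp (from-yes (all? λ d → Alt? (σ d))) 4F 1F t (from-yes (Alt? t))
    (from-yes (flip t ∘ₚ σ 4F ∘ₚ t ≈? σ 1F ∘ₚ σ 1F))
    (involution-order (σ 4F)) (involution-order (σ 1F ∘ₚ σ 1F))
    (from-yes (all? λ d → ¬? (σ d ∘ₚ σ d ≈? σ 4F)))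
  where
  σ = dihedral (square-rotation ∘ₚ transpose 4F 5F) square-reflection
  t = transpose 1F 2F ∘ₚ transpose 4F 5F

threshold : (Q : ℕ → Set₁) → (∀ {k n} → Q k → k ≤ n → Q n) → ∀ t → Q (suc t) → ¬ Q t → ∀ n → Q n ⇔ suc t ≤ n
threshold Q Q-≤ t Q[1+t] ¬Q[t] n = mk⇔ above (Q-≤ Q[1+t])
  where
  above : Q n → suc t ≤ n
  above Qn with n ≤? t
  ... | yes n≤t = ⊥-elim (¬Q[t] (Q-≤ Qn n≤t))
  ... | no  n≰t = ≰⇒> n≰t

corollary4p9 : ((n : ℕ) → P⁺2 (Sym n) ⇔ 4 ≤ n)
             × ((n : ℕ) → P⁺2 (Alt n) ⇔ 6 ≤ n)
corollary4p9 = threshold (P⁺2 ∘ Sym) P⁺2-Sym-≤ 3 P⁺2-Sym4 ¬P⁺2-Sym3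
             , threshold (P⁺2 ∘ Alt) P⁺2-Alt-≤ 5 P⁺2-Alt6 ¬P⁺2-Alt5
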